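{- Let $G$ be a graph with a list assignment $L$ (a set $L(x)$ of colors for each $x\in V(G)\cup E(G)$). Suppose $G$ contains a cycle $u_1u_2u_3u_4$ with $u_2u_4\in E(G)$ and $d(u_2)=d(u_4)=3$, and that $G'=G-\{u_2,u_4\}$ has an $L'$-total coloring $\varphi'$, where $L'(x)=L(x)$ for each $x\in V(G')\cup E(G')$. If $|L_{av}(u_2u_4,\varphi')|\geq 6$, $\min\{|L_{av}(u_2,\varphi')|,|L_{av}(u_4,\varphi')|\}\geq 4$, $\min\{|L_{av}(u_1u_2,\varphi')|,|L_{av}(u_2u_3,\varphi')|,|L_{av}(u_3u_4,\varphi')|,|L_{av}(u_1u_4,\varphi')|\}\geq 2$, and $L_{av}(u_1u_2,\varphi')\neq L_{av}(u_2u_3,\varphi')$ whenever $|L_{av}(u_1u_2,\varphi')|=|L_{av}(u_2u_3,\varphi')|=2$, then $\varphi'$ can be extended to an $L$-total coloring $\varphi$ of $G$ without altering the colors in $G'$.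
   Context: A total coloring assigns colors to vertices and edges so that adjacent vertices, adjacent edges (sharing an endpoint), and a vertex and an incident edge receive different colors. An $L$-total coloring is a total coloring $\varphi$ with $\varphi(x)\in L(x)$ for every element $x$. For an uncolored element $x$ of $G$ and a partial coloring $\varphi'$ (here a coloring of $G'$), the available list $L_{av}(x,\varphi')$ is the set of colors in $L(x)$ not used by $\varphi'$ on any colored element adjacent or incident to $x$. -}

module Defs where

open import Data.Nat using (ℕ; _≟_)
open import Data.Bool using (Bool; true; false; T; not; _∧_; _∨_; if_then_else_)
open import Data.Fin using (Fin)
import Data.Fin as F
open import Data.List using (List; []; _∷_; _++_; filter; length; deduplicate; concatMap)
open import Data.List.Membership.Propositional using (_∈_)
open import Data.List.Membership.DecPropositional _≟_ using (_∈?_)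
open import Data.Product using (_×_)
open import Relation.Nullary using (¬_; ⌊_⌋; ¬?)
open import Relation.Binary.PropositionalEquality using (_≡_)
open import Data.Fin.Properties using () renaming (_≟_ to _≟ᶠ_)

record Graph (n : ℕ) : Set where
  field
    adj     : Fin n → Fin n → Bool
    adj-sym : ∀ u v → adj u v ≡ adj v u
    adj-irr : ∀ u → adj u u ≡ false
open Graph public

Adj : ∀ {n} → Graph n → Fin n → Fin n → Set
Adj G u v = T (adj G u v)

verts : ∀ n → List (Fin n)
verts n = Data.List.allFin n

deg : ∀ {n} → Graph n → Fin n → ℕ
deg {n} G u = length (filter (λ v → Data.Bool.T? (adj G u v)) (verts n))

-- Colours are natural numbers; a list assignment gives a list of colours to every
-- vertex and to every edge (edges uv given by ordered pairs; the assignment on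
-- edges is required to be symmetric where it is used).
record ListAssignment (n : ℕ) : Set where
  field
    LV : Fin n → List ℕ
    LE : Fin n → Fin n → List ℕ
open ListAssignment public

-- A (candidate) colouring of elements: vertex colours and edge colours
-- (edge colour of uv is ce u v; values on non-edges are irrelevant).
record Colouring (n : ℕ) : Set where
  field
    cv : Fin n → ℕ
    ce : Fin n → Fin n → ℕ
open Colouring public

-- L-total colouring of the subgraph of G induced by the vertices w with T (keep w).
record IsTotalColouringOn {n} (G : Graph n) (L : ListAssignment n)
                          (keep : Fin n → Bool) (φ : Colouring n) : Set where
  field
    edge-sym   : ∀ u v → T (keep u) → T (keep v) → Adj G u v → ce φ u v ≡ ce φ v u
    vert-list  : ∀ u → T (keep u) → cv φ u ∈ LV L u
    edge-list  : ∀ u v → T (keep u) → T (keep v) → Adj G u v → ce φ u v ∈ LE L u v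
    vert-vert  : ∀ u v → T (keep u) → T (keep v) → Adj G u v → ¬ (cv φ u ≡ cv φ v)
    edge-edge  : ∀ u v w → T (keep u) → T (keep v) → T (keep w) →
                 Adj G u v → Adj G u w → ¬ (v ≡ w) → ¬ (ce φ u v ≡ ce φ u w)
    vert-edge  : ∀ u v → T (keep u) → T (keep v) → Adj G u v → ¬ (cv φ u ≡ ce φ u v)

everything : ∀ {n} → Fin n → Bool
everything _ = true

IsTotalColouring : ∀ {n} → Graph n → ListAssignment n → Colouring n → Set
IsTotalColouring G L φ = IsTotalColouringOn G L everything φ

-- Colours of coloured elements (w.r.t. keep) adjacent or incident to the vertex x.
forbiddenV : ∀ {n} → Graph n → (Fin n → Bool) → Colouring n → Fin n → List ℕ
forbiddenV {n} G keep φ x =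
  concatMap (λ w → (if adj G x w ∧ keep w then cv φ w ∷ [] else [])
                ++ (if adj G x w ∧ keep x ∧ keep w then ce φ x w ∷ [] else []))
            (verts n)

-- Colours of coloured elements adjacent or incident to the edge xy:
-- the endpoints x, y, and the edges xw (w ≠ y) and yw (w ≠ x).
forbiddenE : ∀ {n} → Graph n → (Fin n → Bool) → Colouring n → Fin n → Fin n → List ℕ
forbiddenE {n} G keep φ x y =
  (if keep x then cv φ x ∷ [] else []) ++
  (if keep y then cv φ y ∷ [] else []) ++
  concatMap (λ w → (if adj G x w ∧ not ⌊ w ≟ᶠ y ⌋ ∧ keep x ∧ keep w then ce φ x w ∷ [] else [])
                ++ (if adj G y w ∧ not ⌊ w ≟ᶠ x ⌋ ∧ keep y ∧ keep w then ce φ y w ∷ [] else []))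
            (verts n)

LavV : ∀ {n} → Graph n → ListAssignment n → (Fin n → Bool) → Colouring n → Fin n → List ℕ
LavV G L keep φ x = filter (λ c → ¬? (c ∈? forbiddenV G keep φ x)) (LV L x)

LavE : ∀ {n} → Graph n → ListAssignment n → (Fin n → Bool) → Colouring n → Fin n → Fin n → List ℕ
LavE G L keep φ x y = filter (λ c → ¬? (c ∈? forbiddenE G keep φ x y)) (LE L x y)

card : List ℕ → ℕ
card xs = length (deduplicate _≟_ xs)

SameSet : List ℕ → List ℕ → Set
SameSet A B = ∀ c → (c ∈ A → c ∈ B) × (c ∈ B → c ∈ A)

minus2 : ∀ {n} → Fin n → Fin n → Fin n → Bool
minus2 a b w = not (⌊ w ≟ᶠ a ⌋ ∨ ⌊ w ≟ᶠ b ⌋)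

module Submission where

-- Lemma 3.3 (reducible configuration): a 4-cycle u₁u₂u₃u₄ with chord u₂u₄ and
-- d(u₂) = d(u₄) = 3.  An L'-total colouring φ′ of G′ = G - {u₂, u₄} is extended
-- by colouring the seven uncoloured elements: the cycle edges u₁u₂, u₂u₃, u₃u₄,
-- u₄u₁ (colours a, b, c, d), the vertices u₂, u₄ (p, q) and the chord u₂u₄ (e).
--
-- The chord e needs six forbidden colours avoided
-- but only |E| ≥ 6 is known, so every case finds a saving: a = c or b = d (if
-- A ∩ C or B ∩ D is nonempty), or a colour of the cycle missing from P or
-- reusable at u₄, or a colour of P ∖ Q outside {a, b}; the hypothesis that
-- L_av(u₁u₂) and L_av(u₂u₃) are not the same 2-set rules out the last gap.

open import Defs
open import Data.Nat using (ℕ; suc; _≤_; _<_; z≤n; s≤s; _≟_)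
open import Data.Nat.Properties using (≤-trans; ≤-antisym; n≤1+n; <⇒≱)
open import Data.Bool using (Bool; true; T; not; _∧_; if_then_else_)
open import Data.Bool.Properties using (T-∧; T?)
open import Data.Fin using (Fin)
open import Data.Fin.Properties using () renaming (_≟_ to _≟ᶠ_)
open import Data.List using (List; []; _∷_; length; filter; allFin)
open import Data.List.Relation.Unary.Any using (here; there; any?)
open import Data.List.Relation.Unary.All using ([]; _∷_)
import Data.List.Relation.Unary.All as All
open import Data.List.Relation.Unary.All.Properties using (¬Any⇒All¬)
open import Data.List.Relation.Unary.AllPairs using ([]; _∷_)
open import Data.List.Relation.Unary.Unique.Propositional using (Unique)
open import Data.List.Relation.Unary.Unique.DecPropositional.Properties _≟_ using (deduplicate-!)
open import Data.List.Relation.Binary.Subset.Propositional using (_⊆_)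
open import Data.List.Membership.Propositional using (_∈_; _∉_; find; lose)
open import Data.List.Membership.Propositional.Properties
  using (∈-deduplicate⁻; ∈-filter⁻; ∈-filter⁺; ∈-allFin; ∈-++⁺ˡ; ∈-++⁺ʳ; ∈-concatMap⁺)
open import Data.List.Membership.DecPropositional _≟_ using (_∈?_)
open import Data.Product using (Σ; _×_; _,_; proj₁; proj₂)
open import Data.Sum using (_⊎_; inj₁; inj₂; [_,_])
open import Data.Unit using (⊤; tt)
open import Data.Empty using (⊥; ⊥-elim)
open import Function.Bundles using (Equivalence)
open import Relation.Nullary using (¬_; yes; no; ¬?; ⌊_⌋; contradiction)
open import Relation.Nullary.Decidable using (decidable-stable; fromWitnessFalse)
open import Relation.Binary.PropositionalEquality using (_≡_; _≢_; refl; sym; ≢-sym; subst)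

module _ {A : Set} where
  remove : ∀ {x : A} (ys : List A) → x ∈ ys → List A
  remove (y ∷ ys) (here _)   = ys
  remove (y ∷ ys) (there x∈) = y ∷ remove ys x∈

  length-remove : ∀ {x : A} (ys : List A) (x∈ : x ∈ ys) → suc (length (remove ys x∈)) ≡ length ys
  length-remove (y ∷ ys) (here _)   = refl
  length-remove (y ∷ ys) (there x∈) rewrite length-remove ys x∈ = refl

  ∈-remove : ∀ {x z : A} (ys : List A) (x∈ : x ∈ ys) → z ∈ ys → z ≢ x → z ∈ remove ys x∈
  ∈-remove (y ∷ ys) (here refl) (here refl) z≢x = contradiction refl z≢x
  ∈-remove (y ∷ ys) (here refl) (there z∈)  _   = z∈
  ∈-remove (y ∷ ys) (there x∈)  (here z≡y)  _   = here z≡y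
  ∈-remove (y ∷ ys) (there x∈)  (there z∈)  z≢x = there (∈-remove ys x∈ z∈ z≢x)

  unique⊆⇒length≤ : ∀ {xs ys : List A} → Unique xs → xs ⊆ ys → length xs ≤ length ys
  unique⊆⇒length≤ {[]}     _                 _   = z≤n
  unique⊆⇒length≤ {x ∷ xs} {ys} (x∉xs ∷ uniq) xs⊆ =
    subst (suc (length xs) ≤_) (length-remove ys x∈ys)
      (s≤s (unique⊆⇒length≤ uniq λ z∈xs →
        ∈-remove ys x∈ys (xs⊆ (there z∈xs)) (≢-sym (All.lookup x∉xs z∈xs))))
    where
    x∈ys : x ∈ ys
    x∈ys = xs⊆ (here refl)

card-⊆ : ∀ {X ys : List ℕ} → X ⊆ ys → card X ≤ length ys
card-⊆ {X} X⊆ = unique⊆⇒length≤ (deduplicate-! X) (λ z∈ → X⊆ (∈-deduplicate⁻ _≟_ X z∈))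

-- "x differs from every entry of ys", as an iterated product so that the
-- individual inequalities can be named by a pattern.
Avoids : ℕ → List ℕ → Set
Avoids x []       = ⊤
Avoids x (y ∷ ys) = x ≢ y × Avoids x ys

∉⇒Avoids : ∀ {x} ys → x ∉ ys → Avoids x ys
∉⇒Avoids []       _    = tt
∉⇒Avoids (y ∷ ys) x∉ys = (λ x≡y → x∉ys (here x≡y)) , ∉⇒Avoids ys (λ x∈ → x∉ys (there x∈))

∈-∉⇒≢ : ∀ {x y : ℕ} {X : List ℕ} → x ∈ X → y ∉ X → x ≢ y
∈-∉⇒≢ x∈ y∉ refl = y∉ x∈

⊆-or-outside : ∀ (X ys : List ℕ) → X ⊆ ys ⊎ Σ ℕ λ t → t ∈ X × t ∉ ys
⊆-or-outside X ys with any? (λ x → ¬? (x ∈? ys)) X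
... | yes found = inj₂ (find found)
... | no  none  = inj₁ λ {z} z∈X → decidable-stable (z ∈? ys) (All.lookup (¬Any⇒All¬ X none) z∈X)

choose : ∀ (X ys : List ℕ) → length ys < card X → Σ ℕ λ x → x ∈ X × Avoids x ys
choose X ys ys<X with ⊆-or-outside X ys
... | inj₁ X⊆ys              = contradiction (card-⊆ X⊆ys) (<⇒≱ ys<X)
... | inj₂ (x , x∈X , x∉ys) = x , x∈X , ∉⇒Avoids ys x∉ys

fills-pair : ∀ {X : List ℕ} {a b : ℕ} → 2 ≤ card X → X ⊆ (a ∷ b ∷ []) →
             card X ≡ 2 × SameSet X (a ∷ b ∷ [])
fills-pair {X} {a} {b} 2≤X X⊆ab =
  ≤-antisym (card-⊆ X⊆ab) 2≤X ,
  λ z → X⊆ab , λ { (here refl) → a∈X ; (there (here refl)) → b∈X }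
  where
  second∈ : ∀ {x y} → X ⊆ (x ∷ y ∷ []) → y ∈ X
  second∈ {x} {y} X⊆xy with y ∈? X
  ... | yes y∈X = y∈X
  ... | no  y∉X = contradiction (card-⊆ X⊆x) (<⇒≱ 2≤X)
    where
    X⊆x : X ⊆ (x ∷ [])
    X⊆x z∈X with X⊆xy z∈X
    ... | here z≡x          = here z≡x
    ... | there (here refl) = contradiction z∈X y∉X
  b∈X : b ∈ X
  b∈X = second∈ X⊆ab
  a∈X : a ∈ X
  a∈X = second∈ λ z∈X → swap (X⊆ab z∈X)
    where
    swap : ∀ {z} → z ∈ (a ∷ b ∷ []) → z ∈ (b ∷ a ∷ [])
    swap (here z≡a)         = there (here z≡a)
    swap (there (here z≡b)) = here z≡b

Disjoint : List ℕ → List ℕ → Set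
Disjoint X Y = ∀ {z} → z ∈ X → z ∈ Y → ⊥

record CycleColouring (A B C D : List ℕ) : Set where
  field
    a b c d : ℕ
    a∈ : a ∈ A
    b∈ : b ∈ B
    c∈ : c ∈ C
    d∈ : d ∈ D
    a≢b : a ≢ b
    b≢c : b ≢ c
    c≢d : c ≢ d
    d≢a : d ≢ a

record Extension (A B C D P Q E : List ℕ) : Set where
  field
    cycle : CycleColouring A B C D
    p q e : ℕ
    p∈ : p ∈ P
    q∈ : q ∈ Q
    e∈ : e ∈ E
  open CycleColouring cycle
  field
    p≢q : p ≢ q
    p≢a : p ≢ a
    p≢b : p ≢ b
    p≢e : p ≢ e
    q≢c : q ≢ c
    q≢d : q ≢ d
    q≢e : q ≢ e
    e≢a : e ≢ a
    e≢b : e ≢ b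
    e≢c : e ≢ c
    e≢d : e ≢ d

-- If t ∉ Z we colour greedily from X; otherwise from Z, and the last colour
-- x ∈ X differs from t ∈ Z because X and Z are disjoint.
colour-path : ∀ (X Y Z : List ℕ) → 2 ≤ card X → 2 ≤ card Y → 2 ≤ card Z → Disjoint X Z →
              (t : ℕ) → Σ ℕ λ x → Σ ℕ λ y → Σ ℕ λ z →
              x ∈ X × y ∈ Y × z ∈ Z × t ≢ x × x ≢ y × y ≢ z × z ≢ t
colour-path X Y Z 2≤X 2≤Y 2≤Z X∩Z=∅ t with t ∈? Z
... | no t∉Z =
  let (x , x∈ , x≢t , _) = choose X (t ∷ []) 2≤X
      (y , y∈ , y≢x , _) = choose Y (x ∷ []) 2≤Y
      (z , z∈ , z≢y , _) = choose Z (y ∷ []) 2≤Z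
  in x , y , z , x∈ , y∈ , z∈ , ≢-sym x≢t , ≢-sym y≢x , ≢-sym z≢y ,
     (λ z≡t → t∉Z (subst (_∈ Z) z≡t z∈))
... | yes t∈Z =
  let (z , z∈ , z≢t , _) = choose Z (t ∷ []) 2≤Z
      (y , y∈ , y≢z , _) = choose Y (z ∷ []) 2≤Y
      (x , x∈ , x≢y , _) = choose X (y ∷ []) 2≤X
  in x , y , z , x∈ , y∈ , z∈ , (λ t≡x → X∩Z=∅ (subst (_∈ X) (sym t≡x) x∈) t∈Z) ,
     x≢y , y≢z , z≢t

module ChooseColours (A B C D P Q E : List ℕ)
  (2≤A : 2 ≤ card A) (2≤B : 2 ≤ card B) (2≤C : 2 ≤ card C) (2≤D : 2 ≤ card D)
  (4≤P : 4 ≤ card P) (4≤Q : 4 ≤ card Q) (6≤E : 6 ≤ card E)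
  (A≠B : card A ≡ 2 → card B ≡ 2 → ¬ SameSet A B) where

  open CycleColouring

  3≤P : 3 ≤ card P
  3≤P = ≤-trans (n≤1+n 3) 4≤P
  3≤Q : 3 ≤ card Q
  3≤Q = ≤-trans (n≤1+n 3) 4≤Q

  -- If a = c, the chord only has to avoid five distinct colours.
  complete-a≡c : (k : CycleColouring A B C D) → a k ≡ c k → Extension A B C D P Q E
  complete-a≡c k a≡c =
    let (p , p∈ , p≢a , p≢b , _) = choose P (a k ∷ b k ∷ []) 3≤P
        (q , q∈ , q≢c , q≢d , q≢p , _) = choose Q (c k ∷ d k ∷ p ∷ []) 4≤Q
        (e , e∈ , e≢a , e≢b , e≢d , e≢p , e≢q , _) = choose E (a k ∷ b k ∷ d k ∷ p ∷ q ∷ []) 6≤E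
    in record { cycle = k ; p = p ; q = q ; e = e ; p∈ = p∈ ; q∈ = q∈ ; e∈ = e∈
              ; p≢q = ≢-sym q≢p ; p≢a = p≢a ; p≢b = p≢b ; p≢e = ≢-sym e≢p
              ; q≢c = q≢c ; q≢d = q≢d ; q≢e = ≢-sym e≢q
              ; e≢a = e≢a ; e≢b = e≢b ; e≢c = subst (e ≢_) a≡c e≢a ; e≢d = e≢d }

  complete-b≡d : (k : CycleColouring A B C D) → b k ≡ d k → Extension A B C D P Q E
  complete-b≡d k b≡d =
    let (p , p∈ , p≢a , p≢b , _) = choose P (a k ∷ b k ∷ []) 3≤P
        (q , q∈ , q≢c , q≢d , q≢p , _) = choose Q (c k ∷ d k ∷ p ∷ []) 4≤Q
        (e , e∈ , e≢a , e≢b , e≢c , e≢p , e≢q , _) = choose E (a k ∷ b k ∷ c k ∷ p ∷ q ∷ []) 6≤E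
    in record { cycle = k ; p = p ; q = q ; e = e ; p∈ = p∈ ; q∈ = q∈ ; e∈ = e∈
              ; p≢q = ≢-sym q≢p ; p≢a = p≢a ; p≢b = p≢b ; p≢e = ≢-sym e≢p
              ; q≢c = q≢c ; q≢d = q≢d ; q≢e = ≢-sym e≢q
              ; e≢a = e≢a ; e≢b = e≢b ; e≢c = e≢c ; e≢d = subst (e ≢_) b≡d e≢b }

  -- If a ∉ P or b ∉ P, p is chosen last: it only has to avoid q, e and the
  -- one of a, b that lies in P.
  complete-p-last : (k : CycleColouring A B C D) → a k ∉ P ⊎ b k ∉ P → Extension A B C D P Q E
  complete-p-last k a∉P⊎b∉P =
    let (q , q∈ , q≢c , q≢d , _) = choose Q (c k ∷ d k ∷ []) 3≤Q
        (e , e∈ , e≢a , e≢b , e≢c , e≢d , e≢q , _) = choose E (a k ∷ b k ∷ c k ∷ d k ∷ q ∷ []) 6≤E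
        (p , p∈ , p≢a , p≢b , p≢q , p≢e , _) = choose-p a∉P⊎b∉P q e
    in record { cycle = k ; p = p ; q = q ; e = e ; p∈ = p∈ ; q∈ = q∈ ; e∈ = e∈
              ; p≢q = p≢q ; p≢a = p≢a ; p≢b = p≢b ; p≢e = p≢e
              ; q≢c = q≢c ; q≢d = q≢d ; q≢e = ≢-sym e≢q
              ; e≢a = e≢a ; e≢b = e≢b ; e≢c = e≢c ; e≢d = e≢d }
    where
    choose-p : a k ∉ P ⊎ b k ∉ P → ∀ q e → Σ ℕ λ p → p ∈ P × Avoids p (a k ∷ b k ∷ q ∷ e ∷ [])
    choose-p (inj₁ a∉P) q e =
      let (p , p∈ , p≢b , p≢q , p≢e , _) = choose P (b k ∷ q ∷ e ∷ []) 4≤P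
      in p , p∈ , ∈-∉⇒≢ p∈ a∉P , p≢b , p≢q , p≢e , tt
    choose-p (inj₂ b∉P) q e =
      let (p , p∈ , p≢a , p≢q , p≢e , _) = choose P (a k ∷ q ∷ e ∷ []) 4≤P
      in p , p∈ , p≢a , ∈-∉⇒≢ p∈ b∉P , p≢q , p≢e , tt

  -- If a colour t ∈ {a, b} of Q differs from c and d, take q = t; then q is
  -- already among the colours avoided by p and e.
  complete-q-on-cycle : (k : CycleColouring A B C D) (t : ℕ) → t ∈ Q → t ≡ a k ⊎ t ≡ b k →
                        t ≢ c k → t ≢ d k → Extension A B C D P Q E
  complete-q-on-cycle k t t∈Q t∈ab t≢c t≢d =
    let (p , p∈ , p≢a , p≢b , _) = choose P (a k ∷ b k ∷ []) 3≤P
        (e , e∈ , e≢a , e≢b , e≢c , e≢d , e≢p , _) = choose E (a k ∷ b k ∷ c k ∷ d k ∷ p ∷ []) 6≤E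
    in record { cycle = k ; p = p ; q = t ; e = e ; p∈ = p∈ ; q∈ = t∈Q ; e∈ = e∈
              ; p≢q = ≢-on-ab p≢a p≢b ; p≢a = p≢a ; p≢b = p≢b ; p≢e = ≢-sym e≢p
              ; q≢c = t≢c ; q≢d = t≢d ; q≢e = ≢-sym (≢-on-ab e≢a e≢b)
              ; e≢a = e≢a ; e≢b = e≢b ; e≢c = e≢c ; e≢d = e≢d }
    where
    ≢-on-ab : ∀ {x} → x ≢ a k → x ≢ b k → x ≢ t
    ≢-on-ab x≢a x≢b = [ (λ t≡a → subst (_ ≢_) (sym t≡a) x≢a) , (λ t≡b → subst (_ ≢_) (sym t≡b) x≢b) ] t∈ab

  -- If some t ∈ P ∖ Q differs from a and b, take p = t; then q, chosen last,
  -- differs from p automatically.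
  complete-p-outside-Q : (k : CycleColouring A B C D) (t : ℕ) → t ∈ P → t ∉ Q →
                         t ≢ a k → t ≢ b k → Extension A B C D P Q E
  complete-p-outside-Q k t t∈P t∉Q t≢a t≢b =
    let (e , e∈ , e≢a , e≢b , e≢c , e≢d , e≢t , _) = choose E (a k ∷ b k ∷ c k ∷ d k ∷ t ∷ []) 6≤E
        (q , q∈ , q≢c , q≢d , q≢e , _) = choose Q (c k ∷ d k ∷ e ∷ []) 4≤Q
    in record { cycle = k ; p = t ; q = q ; e = e ; p∈ = t∈P ; q∈ = q∈ ; e∈ = e∈
              ; p≢q = ≢-sym (∈-∉⇒≢ q∈ t∉Q) ; p≢a = t≢a ; p≢b = t≢b ; p≢e = ≢-sym e≢t
              ; q≢c = q≢c ; q≢d = q≢d ; q≢e = q≢e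
              ; e≢a = e≢a ; e≢b = e≢b ; e≢c = e≢c ; e≢d = e≢d }

  Critical : CycleColouring A B C D → Set
  Critical k = (a k ∈ P × b k ∈ P) × (a k ∉ Q × b k ∉ Q)

  complete-or-critical : (k : CycleColouring A B C D) → a k ≢ c k → b k ≢ d k →
                         Extension A B C D P Q E ⊎ Critical k
  complete-or-critical k a≢c b≢d with a k ∈? P | b k ∈? P | a k ∈? Q | b k ∈? Q
  ... | no a∉P  | _       | _       | _       = inj₁ (complete-p-last k (inj₁ a∉P))
  ... | yes _   | no b∉P  | _       | _       = inj₁ (complete-p-last k (inj₂ b∉P))
  ... | yes _   | yes _   | yes a∈Q | _       = inj₁ (complete-q-on-cycle k (a k) a∈Q (inj₁ refl) a≢c (≢-sym (d≢a k)))
  ... | yes _   | yes _   | no _    | yes b∈Q = inj₁ (complete-q-on-cycle k (b k) b∈Q (inj₂ refl) (b≢c k) b≢d)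
  ... | yes a∈P | yes b∈P | no a∉Q  | no b∉Q  = inj₂ ((a∈P , b∈P) , (a∉Q , b∉Q))

  cycle-with-a≡c : ∀ {x} → x ∈ A → x ∈ C → CycleColouring A B C D
  cycle-with-a≡c {x} x∈A x∈C =
    let (b , b∈ , b≢x , _) = choose B (x ∷ []) 2≤B
        (d , d∈ , d≢x , _) = choose D (x ∷ []) 2≤D
    in record { a = x ; b = b ; c = x ; d = d ; a∈ = x∈A ; b∈ = b∈ ; c∈ = x∈C ; d∈ = d∈
              ; a≢b = ≢-sym b≢x ; b≢c = b≢x ; c≢d = ≢-sym d≢x ; d≢a = d≢x }

  cycle-with-b≡d : ∀ {y} → y ∈ B → y ∈ D → CycleColouring A B C D
  cycle-with-b≡d {y} y∈B y∈D =
    let (a , a∈ , a≢y , _) = choose A (y ∷ []) 2≤A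
        (c , c∈ , c≢y , _) = choose C (y ∷ []) 2≤C
    in record { a = a ; b = y ; c = c ; d = y ; a∈ = a∈ ; b∈ = y∈B ; c∈ = c∈ ; d∈ = y∈D
              ; a≢b = a≢y ; b≢c = ≢-sym c≢y ; c≢d = c≢y ; d≢a = ≢-sym a≢y }

  module _ (A∩C=∅ : Disjoint A C) (B∩D=∅ : Disjoint B D) where

    cycle-through-a : ∀ t → t ∈ A → CycleColouring A B C D
    cycle-through-a t t∈A =
      let (x , y , z , x∈ , y∈ , z∈ , t≢x , x≢y , y≢z , z≢t) =
            colour-path B C D 2≤B 2≤C 2≤D B∩D=∅ t
      in record { a = t ; b = x ; c = y ; d = z ; a∈ = t∈A ; b∈ = x∈ ; c∈ = y∈ ; d∈ = z∈
                ; a≢b = t≢x ; b≢c = x≢y ; c≢d = y≢z ; d≢a = z≢t }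

    cycle-through-b : ∀ t → t ∈ B → CycleColouring A B C D
    cycle-through-b t t∈B =
      let (x , y , z , x∈ , y∈ , z∈ , t≢x , x≢y , y≢z , z≢t) =
            colour-path C D A 2≤C 2≤D 2≤A (λ x∈C x∈A → A∩C=∅ x∈A x∈C) t
      in record { a = z ; b = t ; c = x ; d = y ; a∈ = z∈ ; b∈ = t∈B ; c∈ = x∈ ; d∈ = y∈
                ; a≢b = z≢t ; b≢c = t≢x ; c≢d = x≢y ; d≢a = y≢z }

    complete-or-critical′ : (k : CycleColouring A B C D) → Extension A B C D P Q E ⊎ Critical k
    complete-or-critical′ k = complete-or-critical k
      (λ a≡c → A∩C=∅ (a∈ k) (subst (_∈ C) (sym a≡c) (c∈ k)))
      (λ b≡d → B∩D=∅ (b∈ k) (subst (_∈ D) (sym b≡d) (d∈ k)))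

    -- Recolouring through a colour t ∉ {a, b} of k either extends, or is critical
    -- as well; then t ∈ P ∖ Q, and k extends with p = t.
    via-recolouring : (k k′ : CycleColouring A B C D) (t : ℕ) → t ∉ (a k ∷ b k ∷ []) →
                      t ≡ a k′ ⊎ t ≡ b k′ → Extension A B C D P Q E
    via-recolouring k k′ t t∉ab t-on-k′ with complete-or-critical′ k′
    ... | inj₁ extension = extension
    ... | inj₂ ((a′∈P , b′∈P) , (a′∉Q , b′∉Q)) =
      complete-p-outside-Q k t
        ([ (λ t≡a′ → subst (_∈ P) (sym t≡a′) a′∈P) , (λ t≡b′ → subst (_∈ P) (sym t≡b′) b′∈P) ] t-on-k′)
        ([ (λ t≡a′ → subst (_∉ Q) (sym t≡a′) a′∉Q) , (λ t≡b′ → subst (_∉ Q) (sym t≡b′) b′∉Q) ] t-on-k′)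
        (λ t≡a → t∉ab (here t≡a)) (λ t≡b → t∉ab (there (here t≡b)))

    not-both-in-pair : ∀ {a b} → A ⊆ (a ∷ b ∷ []) → B ⊆ (a ∷ b ∷ []) → ⊥
    not-both-in-pair A⊆ab B⊆ab =
      let (|A|≡2 , A≈ab) = fills-pair 2≤A A⊆ab
          (|B|≡2 , B≈ab) = fills-pair 2≤B B⊆ab
      in A≠B |A|≡2 |B|≡2 λ z → (λ z∈A → proj₂ (B≈ab z) (proj₁ (A≈ab z) z∈A))
                              , (λ z∈B → proj₂ (A≈ab z) (proj₁ (B≈ab z) z∈B))

    k₀ : CycleColouring A B C D
    k₀ = let (t , t∈A , _) = choose A [] (≤-trans (n≤1+n 1) 2≤A) in cycle-through-a t t∈A

    -- Start from any cycle colouring k₀; if it is critical, recolour through a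
    -- colour of A or B outside {a, b}, which exists because A and B differ.
    extension-disjoint : Extension A B C D P Q E
    extension-disjoint with complete-or-critical′ k₀
    ... | inj₁ extension = extension
    ... | inj₂ _ with ⊆-or-outside A (a k₀ ∷ b k₀ ∷ []) | ⊆-or-outside B (a k₀ ∷ b k₀ ∷ [])
    ...   | inj₂ (t , t∈A , t∉ab) | _ = via-recolouring k₀ (cycle-through-a t t∈A) t t∉ab (inj₁ refl)
    ...   | inj₁ _ | inj₂ (t , t∈B , t∉ab) = via-recolouring k₀ (cycle-through-b t t∈B) t t∉ab (inj₂ refl)
    ...   | inj₁ A⊆ab | inj₁ B⊆ab = ⊥-elim (not-both-in-pair A⊆ab B⊆ab)

  extension : Extension A B C D P Q E
  extension with any? (_∈? C) A
  ... | yes common = let (x , x∈A , x∈C) = find common in complete-a≡c (cycle-with-a≡c x∈A x∈C) refl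
  ... | no A∩C=∅ with any? (_∈? D) B
  ...   | yes common = let (y , y∈B , y∈D) = find common in complete-b≡d (cycle-with-b≡d y∈B y∈D) refl
  ...   | no B∩D=∅ = extension-disjoint (λ x∈A x∈C → A∩C=∅ (lose x∈A x∈C))
                                         (λ y∈B y∈D → B∩D=∅ (lose y∈B y∈D))

module Available {n} (G : Graph n) (L : ListAssignment n) (keep : Fin n → Bool) (φ : Colouring n) where

  private
    LavV-∈ : ∀ {c x} → c ∈ LavV G L keep φ x → c ∈ LV L x × c ∉ forbiddenV G keep φ x
    LavV-∈ {x = x} = ∈-filter⁻ (λ c → ¬? (c ∈? forbiddenV G keep φ x)) {xs = LV L x}

    LavE-∈ : ∀ {c x y} → c ∈ LavE G L keep φ x y → c ∈ LE L x y × c ∉ forbiddenE G keep φ x y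
    LavE-∈ {x = x} {y} = ∈-filter⁻ (λ c → ¬? (c ∈? forbiddenE G keep φ x y)) {xs = LE L x y}

    ∈-if : ∀ {b : Bool} {x : ℕ} → T b → x ∈ (if b then x ∷ [] else [])
    ∈-if {true} _ = here refl

    _∧ᵀ_ : ∀ {b₁ b₂ : Bool} → T b₁ → T b₂ → T (b₁ ∧ b₂)
    t₁ ∧ᵀ t₂ = Equivalence.from T-∧ (t₁ , t₂)

  LavV⊆LV : ∀ {c x} → c ∈ LavV G L keep φ x → c ∈ LV L x
  LavV⊆LV c∈ = proj₁ (LavV-∈ c∈)

  LavE⊆LE : ∀ {c x y} → c ∈ LavE G L keep φ x y → c ∈ LE L x y
  LavE⊆LE c∈ = proj₁ (LavE-∈ c∈)

  LavV-forbidden : ∀ {c d x} → c ∈ LavV G L keep φ x → d ∈ forbiddenV G keep φ x → c ≢ d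
  LavV-forbidden c∈ d∈F = ≢-sym (∈-∉⇒≢ d∈F (proj₂ (LavV-∈ c∈)))

  LavE-forbidden : ∀ {c d x y} → c ∈ LavE G L keep φ x y → d ∈ forbiddenE G keep φ x y → c ≢ d
  LavE-forbidden c∈ d∈F = ≢-sym (∈-∉⇒≢ d∈F (proj₂ (LavE-∈ c∈)))

  LavV-vertex : ∀ {c x w} → c ∈ LavV G L keep φ x → Adj G x w → T (keep w) → c ≢ cv φ w
  LavV-vertex {x = x} {w} c∈ x~w kw =
    LavV-forbidden c∈ (∈-concatMap⁺ _ (lose (∈-allFin w) (∈-++⁺ˡ (∈-if (x~w ∧ᵀ kw)))))

  LavE-end₁ : ∀ {c x y} → c ∈ LavE G L keep φ x y → T (keep x) → c ≢ cv φ x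
  LavE-end₁ c∈ kx = LavE-forbidden c∈ (∈-++⁺ˡ (∈-if kx))

  LavE-end₂ : ∀ {c x y} → c ∈ LavE G L keep φ x y → T (keep y) → c ≢ cv φ y
  LavE-end₂ {x = x} c∈ ky = LavE-forbidden c∈ (∈-++⁺ʳ (if keep x then cv φ x ∷ [] else []) (∈-++⁺ˡ (∈-if ky)))

  LavE-edge₁ : ∀ {c x y w} → c ∈ LavE G L keep φ x y → Adj G x w → w ≢ y →
               T (keep x) → T (keep w) → c ≢ ce φ x w
  LavE-edge₁ {x = x} {y} {w} c∈ x~w w≢y kx kw =
    LavE-forbidden c∈ (∈-++⁺ʳ (if keep x then cv φ x ∷ [] else [])
                  (∈-++⁺ʳ (if keep y then cv φ y ∷ [] else [])
                    (∈-concatMap⁺ _ (lose (∈-allFin w)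
                      (∈-++⁺ˡ (∈-if (x~w ∧ᵀ (fromWitnessFalse {a? = w ≟ᶠ y} w≢y ∧ᵀ (kx ∧ᵀ kw)))))))))

  LavE-edge₂ : ∀ {c x y w} → c ∈ LavE G L keep φ x y → Adj G y w → w ≢ x →
               T (keep y) → T (keep w) → c ≢ ce φ y w
  LavE-edge₂ {x = x} {y} {w} c∈ y~w w≢x ky kw =
    LavE-forbidden c∈ (∈-++⁺ʳ (if keep x then cv φ x ∷ [] else [])
                  (∈-++⁺ʳ (if keep y then cv φ y ∷ [] else [])
                    (∈-concatMap⁺ _ (lose (∈-allFin w)
                      (∈-++⁺ʳ (if adj G x w ∧ not ⌊ w ≟ᶠ y ⌋ ∧ keep x ∧ keep w then ce φ x w ∷ [] else [])
                        (∈-if (y~w ∧ᵀ (fromWitnessFalse {a? = w ≟ᶠ x} w≢x ∧ᵀ (ky ∧ᵀ kw)))))))))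

Adj-sym : ∀ {n} (G : Graph n) {u v} → Adj G u v → Adj G v u
Adj-sym G {u} {v} u~v = subst T (adj-sym G u v) u~v

Adj⇒≢ : ∀ {n} (G : Graph n) {u v} → Adj G u v → u ≢ v
Adj⇒≢ G {u} u~u refl = subst T (adj-irr G u) u~u

minus2-intro : ∀ {n} {x y w : Fin n} → w ≢ x → w ≢ y → T (minus2 x y w)
minus2-intro {x = x} {y} {w} w≢x w≢y with w ≟ᶠ x | w ≟ᶠ y
... | yes w≡x | _       = contradiction w≡x w≢x
... | no _    | yes w≡y = contradiction w≡y w≢y
... | no _    | no _    = tt

minus2-elim : ∀ {n} {x y w : Fin n} → T (minus2 x y w) → w ≢ x × w ≢ y
minus2-elim {x = x} {y} {w} kw with w ≟ᶠ x | w ≟ᶠ y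
... | no w≢x | no w≢y = w≢x , w≢y

degree-3-neighbours : ∀ {n} (G : Graph n) {u x y z : Fin n} → x ≢ y → x ≢ z → y ≢ z →
                      deg G u ≡ 3 → Adj G u x → Adj G u y → Adj G u z →
                      ∀ {w} → Adj G u w → w ≡ x ⊎ w ≡ y ⊎ w ≡ z
degree-3-neighbours {n} G {u} {x} {y} {z} x≢y x≢z y≢z deg≡3 u~x u~y u~z {w} u~w
  with w ≟ᶠ x | w ≟ᶠ y | w ≟ᶠ z
... | yes w≡x | _       | _       = inj₁ w≡x
... | no _    | yes w≡y | _       = inj₂ (inj₁ w≡y)
... | no _    | no _    | yes w≡z = inj₂ (inj₂ w≡z)
... | no w≢x  | no w≢y  | no w≢z  = contradiction (subst (4 ≤_) deg≡3 four≤deg) λ { (s≤s (s≤s (s≤s ()))) }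
  where
  nbr : ∀ {v} → Adj G u v → v ∈ filter (λ v → T? (adj G u v)) (allFin n)
  nbr {v} u~v = ∈-filter⁺ (λ v → T? (adj G u v)) (∈-allFin v) u~v
  four≤deg : 4 ≤ deg G u
  four≤deg = unique⊆⇒length≤ {xs = x ∷ y ∷ z ∷ w ∷ []}
    ((x≢y ∷ x≢z ∷ ≢-sym w≢x ∷ []) ∷ (y≢z ∷ ≢-sym w≢y ∷ []) ∷ (≢-sym w≢z ∷ []) ∷ [] ∷ [])
    λ { (here refl) → nbr u~x ; (there (here refl)) → nbr u~y
      ; (there (there (here refl))) → nbr u~z ; (there (there (there (here refl)))) → nbr u~w }

module TwoPoint {n} {x y : Fin n} (x≢y : x ≢ y) (α β : ℕ) where
  value : Fin n → ℕ
  value w with w ≟ᶠ x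
  ... | yes _ = α
  ... | no  _ = β

  value-x : value x ≡ α
  value-x with x ≟ᶠ x
  ... | yes _   = refl
  ... | no x≢x = contradiction refl x≢x

  value-y : value y ≡ β
  value-y with y ≟ᶠ x
  ... | yes y≡x = contradiction (sym y≡x) x≢y
  ... | no _    = refl

  elim : ∀ (R : Fin n → ℕ → Set) → R x α → R y β → ∀ {w} → w ≡ x ⊎ w ≡ y → R w (value w)
  elim R Rx Ry (inj₁ refl) = subst (R x) (sym value-x) Rx
  elim R Rx Ry (inj₂ refl) = subst (R y) (sym value-y) Ry

module Extend {n} (G : Graph n) (L : ListAssignment n) (u₁ u₂ u₃ u₄ : Fin n)
  (L-sym : ∀ u v → Adj G u v → LE L u v ≡ LE L v u)
  (u₁≢u₃ : u₁ ≢ u₃)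
  (u₁~u₂ : Adj G u₁ u₂) (u₂~u₃ : Adj G u₂ u₃) (u₃~u₄ : Adj G u₃ u₄) (u₄~u₁ : Adj G u₄ u₁)
  (u₂~u₄ : Adj G u₂ u₄) (deg-u₂ : deg G u₂ ≡ 3) (deg-u₄ : deg G u₄ ≡ 3)
  (φ′ : Colouring n) (φ′-total : IsTotalColouringOn G L (minus2 u₂ u₄) φ′)
  (choice : Extension (LavE G L (minus2 u₂ u₄) φ′ u₁ u₂) (LavE G L (minus2 u₂ u₄) φ′ u₂ u₃)
                      (LavE G L (minus2 u₂ u₄) φ′ u₃ u₄) (LavE G L (minus2 u₂ u₄) φ′ u₁ u₄)
                      (LavV G L (minus2 u₂ u₄) φ′ u₂) (LavV G L (minus2 u₂ u₄) φ′ u₄)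
                      (LavE G L (minus2 u₂ u₄) φ′ u₂ u₄)) where

  open IsTotalColouringOn φ′-total
  open Extension choice
  open CycleColouring cycle
  open Available G L (minus2 u₂ u₄) φ′

  Kept : Fin n → Set
  Kept w = T (minus2 u₂ u₄ w)

  kept⇒≢u₂ : ∀ {w} → Kept w → w ≢ u₂
  kept⇒≢u₂ kw = let (w≢u₂ , _) = minus2-elim kw in w≢u₂

  kept⇒≢u₄ : ∀ {w} → Kept w → w ≢ u₄
  kept⇒≢u₄ kw = let (_ , w≢u₄) = minus2-elim kw in w≢u₄

  u₁-kept : Kept u₁
  u₁-kept = minus2-intro (Adj⇒≢ G u₁~u₂) (≢-sym (Adj⇒≢ G u₄~u₁))

  u₃-kept : Kept u₃
  u₃-kept = minus2-intro (≢-sym (Adj⇒≢ G u₂~u₃)) (Adj⇒≢ G u₃~u₄)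

  neighbours-u₂ : ∀ {w} → Adj G u₂ w → Kept w → w ≡ u₁ ⊎ w ≡ u₃
  neighbours-u₂ u₂~w kw
    with degree-3-neighbours G u₁≢u₃ (≢-sym (Adj⇒≢ G u₄~u₁)) (Adj⇒≢ G u₃~u₄) deg-u₂
           (Adj-sym G u₁~u₂) u₂~u₃ u₂~u₄ u₂~w
  ... | inj₁ w≡u₁          = inj₁ w≡u₁
  ... | inj₂ (inj₁ w≡u₃)   = inj₂ w≡u₃
  ... | inj₂ (inj₂ w≡u₄)   = contradiction w≡u₄ (kept⇒≢u₄ kw)

  neighbours-u₄ : ∀ {w} → Adj G u₄ w → Kept w → w ≡ u₃ ⊎ w ≡ u₁
  neighbours-u₄ u₄~w kw
    with degree-3-neighbours G (≢-sym u₁≢u₃) (≢-sym (Adj⇒≢ G u₂~u₃)) (Adj⇒≢ G u₁~u₂) deg-u₄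
           (Adj-sym G u₃~u₄) u₄~u₁ (Adj-sym G u₂~u₄) u₄~w
  ... | inj₁ w≡u₃          = inj₁ w≡u₃
  ... | inj₂ (inj₁ w≡u₁)   = inj₂ w≡u₁
  ... | inj₂ (inj₂ w≡u₂)   = contradiction w≡u₂ (kept⇒≢u₂ kw)

  module From-u₂ = TwoPoint u₁≢u₃ a b
  module From-u₄ = TwoPoint (≢-sym u₁≢u₃) c d

  edge-u₂ : Fin n → ℕ
  edge-u₂ = From-u₂.value

  edge-u₄ : Fin n → ℕ
  edge-u₄ = From-u₄.value

  at-u₂ : ∀ (R : Fin n → ℕ → Set) → R u₁ a → R u₃ b → ∀ {w} → Adj G u₂ w → Kept w → R w (edge-u₂ w)
  at-u₂ R R₁ R₃ u₂~w kw = From-u₂.elim R R₁ R₃ (neighbours-u₂ u₂~w kw)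

  at-u₄ : ∀ (R : Fin n → ℕ → Set) → R u₃ c → R u₁ d → ∀ {w} → Adj G u₄ w → Kept w → R w (edge-u₄ w)
  at-u₄ R R₃ R₁ u₄~w kw = From-u₄.elim R R₃ R₁ (neighbours-u₄ u₄~w kw)

  p-vertex : ∀ {w} → Adj G u₂ w → Kept w → p ≢ cv φ′ w
  p-vertex = LavV-vertex p∈

  q-vertex : ∀ {w} → Adj G u₄ w → Kept w → q ≢ cv φ′ w
  q-vertex = LavV-vertex q∈

  a-edges : ∀ {w} → Adj G u₁ w → Kept w → a ≢ ce φ′ u₁ w
  a-edges u₁~w kw = LavE-edge₁ a∈ u₁~w (kept⇒≢u₂ kw) u₁-kept kw

  b-edges : ∀ {w} → Adj G u₃ w → Kept w → b ≢ ce φ′ u₃ w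
  b-edges u₃~w kw = LavE-edge₂ b∈ u₃~w (kept⇒≢u₂ kw) u₃-kept kw

  c-edges : ∀ {w} → Adj G u₃ w → Kept w → c ≢ ce φ′ u₃ w
  c-edges u₃~w kw = LavE-edge₁ c∈ u₃~w (kept⇒≢u₄ kw) u₃-kept kw

  d-edges : ∀ {w} → Adj G u₁ w → Kept w → d ≢ ce φ′ u₁ w
  d-edges u₁~w kw = LavE-edge₁ d∈ u₁~w (kept⇒≢u₄ kw) u₁-kept kw

  edge-u₂-list : ∀ {w} → Adj G u₂ w → Kept w → edge-u₂ w ∈ LE L u₂ w
  edge-u₂-list = at-u₂ (λ w x → x ∈ LE L u₂ w)
    (subst (a ∈_) (L-sym u₁ u₂ u₁~u₂) (LavE⊆LE a∈)) (LavE⊆LE b∈)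

  edge-u₄-list : ∀ {w} → Adj G u₄ w → Kept w → edge-u₄ w ∈ LE L u₄ w
  edge-u₄-list = at-u₄ (λ w x → x ∈ LE L u₄ w)
    (subst (c ∈_) (L-sym u₃ u₄ u₃~u₄) (LavE⊆LE c∈))
    (subst (d ∈_) (L-sym u₁ u₄ (Adj-sym G u₄~u₁)) (LavE⊆LE d∈))

  p-edge-u₂ : ∀ {w} → Adj G u₂ w → Kept w → p ≢ edge-u₂ w
  p-edge-u₂ = at-u₂ (λ _ x → p ≢ x) p≢a p≢b

  q-edge-u₄ : ∀ {w} → Adj G u₄ w → Kept w → q ≢ edge-u₄ w
  q-edge-u₄ = at-u₄ (λ _ x → q ≢ x) q≢c q≢d

  e-edge-u₂ : ∀ {w} → Adj G u₂ w → Kept w → e ≢ edge-u₂ w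
  e-edge-u₂ = at-u₂ (λ _ x → e ≢ x) e≢a e≢b

  e-edge-u₄ : ∀ {w} → Adj G u₄ w → Kept w → e ≢ edge-u₄ w
  e-edge-u₄ = at-u₄ (λ _ x → e ≢ x) e≢c e≢d

  end-edge-u₂ : ∀ {w} → Adj G u₂ w → Kept w → cv φ′ w ≢ edge-u₂ w
  end-edge-u₂ = at-u₂ (λ w x → cv φ′ w ≢ x)
    (≢-sym (LavE-end₁ a∈ u₁-kept)) (≢-sym (LavE-end₂ b∈ u₃-kept))

  end-edge-u₄ : ∀ {w} → Adj G u₄ w → Kept w → cv φ′ w ≢ edge-u₄ w
  end-edge-u₄ = at-u₄ (λ w x → cv φ′ w ≢ x)
    (≢-sym (LavE-end₁ c∈ u₃-kept)) (≢-sym (LavE-end₁ d∈ u₁-kept))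

  edges-u₂-distinct : ∀ {v w} → Adj G u₂ v → Kept v → Adj G u₂ w → Kept w → v ≢ w →
                      edge-u₂ v ≢ edge-u₂ w
  edges-u₂-distinct {w = w} u₂~v kv u₂~w kw = at-u₂ (λ v x → v ≢ w → x ≢ edge-u₂ w)
    (at-u₂ (λ w x → u₁ ≢ w → a ≢ x) (λ u₁≢u₁ → contradiction refl u₁≢u₁) (λ _ → a≢b) u₂~w kw)
    (at-u₂ (λ w x → u₃ ≢ w → b ≢ x) (λ _ → ≢-sym a≢b) (λ u₃≢u₃ → contradiction refl u₃≢u₃) u₂~w kw)
    u₂~v kv

  edges-u₄-distinct : ∀ {v w} → Adj G u₄ v → Kept v → Adj G u₄ w → Kept w → v ≢ w →
                      edge-u₄ v ≢ edge-u₄ w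
  edges-u₄-distinct {w = w} u₄~v kv u₄~w kw = at-u₄ (λ v x → v ≢ w → x ≢ edge-u₄ w)
    (at-u₄ (λ w x → u₃ ≢ w → c ≢ x) (λ u₃≢u₃ → contradiction refl u₃≢u₃) (λ _ → c≢d) u₄~w kw)
    (at-u₄ (λ w x → u₁ ≢ w → d ≢ x) (λ _ → ≢-sym c≢d) (λ u₁≢u₁ → contradiction refl u₁≢u₁) u₄~w kw)
    u₄~v kv

  -- At u₁ the edges to u₂, u₄ have colours a ≠ d, at u₃ they have b ≠ c.
  edge-u₂≢edge-u₄ : ∀ {w} → Adj G u₂ w → Kept w → edge-u₂ w ≢ edge-u₄ w
  edge-u₂≢edge-u₄ = at-u₂ (λ w x → x ≢ edge-u₄ w)
    (subst (a ≢_) (sym From-u₄.value-y) (≢-sym d≢a))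
    (subst (b ≢_) (sym From-u₄.value-x) b≢c)

  edge-u₂-vs-G′ : ∀ {u w} → Adj G u₂ u → Kept u → Adj G u w → Kept w → edge-u₂ u ≢ ce φ′ u w
  edge-u₂-vs-G′ u₂~u ku u~w kw =
    at-u₂ (λ u x → ∀ {w} → Adj G u w → Kept w → x ≢ ce φ′ u w) a-edges b-edges u₂~u ku u~w kw

  edge-u₄-vs-G′ : ∀ {u w} → Adj G u₄ u → Kept u → Adj G u w → Kept w → edge-u₄ u ≢ ce φ′ u w
  edge-u₄-vs-G′ u₄~u ku u~w kw =
    at-u₄ (λ u x → ∀ {w} → Adj G u w → Kept w → x ≢ ce φ′ u w) c-edges d-edges u₄~u ku u~w kw

  data Position (w : Fin n) : Set where
    is-u₂ : w ≡ u₂ → Position w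
    is-u₄ : w ≡ u₄ → Position w
    in-G′ : Kept w → Position w

  position : ∀ w → Position w
  position w with w ≟ᶠ u₂ | w ≟ᶠ u₄
  ... | yes w≡u₂ | _        = is-u₂ w≡u₂
  ... | no _     | yes w≡u₄ = is-u₄ w≡u₄
  ... | no w≢u₂  | no w≢u₄  = in-G′ (minus2-intro w≢u₂ w≢u₄)

  -- The extension: p, q on u₂, u₄; e on u₂u₄; the colours a, b, c, d on the
  -- edges to G′; φ′ on G′ (loops u₂u₂, u₄u₄ are not edges and get any colour).
  vertex-colour : ∀ {w} → Position w → ℕ
  vertex-colour (is-u₂ _)       = p
  vertex-colour (is-u₄ _)       = q
  vertex-colour {w} (in-G′ _)   = cv φ′ w

  edge-colour : ∀ {v w} → Position v → Position w → ℕ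
  edge-colour (is-u₂ _) (is-u₄ _)         = e
  edge-colour (is-u₄ _) (is-u₂ _)         = e
  edge-colour (is-u₂ _) (is-u₂ _)         = 0
  edge-colour (is-u₄ _) (is-u₄ _)         = 0
  edge-colour {w = w} (is-u₂ _) (in-G′ _) = edge-u₂ w
  edge-colour {v} (in-G′ _) (is-u₂ _)     = edge-u₂ v
  edge-colour {w = w} (is-u₄ _) (in-G′ _) = edge-u₄ w
  edge-colour {v} (in-G′ _) (is-u₄ _)     = edge-u₄ v
  edge-colour {v} {w} (in-G′ _) (in-G′ _) = ce φ′ v w

  φ : Colouring n
  φ = record { cv = λ w → vertex-colour (position w) ; ce = λ v w → edge-colour (position v) (position w) }

  edge-sym′ : ∀ u v → Adj G u v → ce φ u v ≡ ce φ v u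
  edge-sym′ u v u~v with position u | position v
  ... | is-u₂ _ | is-u₂ _ = refl
  ... | is-u₂ _ | is-u₄ _ = refl
  ... | is-u₂ _ | in-G′ _ = refl
  ... | is-u₄ _ | is-u₂ _ = refl
  ... | is-u₄ _ | is-u₄ _ = refl
  ... | is-u₄ _ | in-G′ _ = refl
  ... | in-G′ _ | is-u₂ _ = refl
  ... | in-G′ _ | is-u₄ _ = refl
  ... | in-G′ ku | in-G′ kv = edge-sym u v ku kv u~v

  vert-list′ : ∀ u → cv φ u ∈ LV L u
  vert-list′ u with position u
  ... | is-u₂ refl = LavV⊆LV p∈
  ... | is-u₄ refl = LavV⊆LV q∈
  ... | in-G′ ku   = vert-list u ku

  edge-list′ : ∀ u v → Adj G u v → ce φ u v ∈ LE L u v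
  edge-list′ u v u~v with position u | position v
  ... | is-u₂ refl | is-u₄ refl = LavE⊆LE e∈
  ... | is-u₄ refl | is-u₂ refl = subst (e ∈_) (L-sym u₂ u₄ u₂~u₄) (LavE⊆LE e∈)
  ... | is-u₂ refl | is-u₂ refl = contradiction refl (Adj⇒≢ G u~v)
  ... | is-u₄ refl | is-u₄ refl = contradiction refl (Adj⇒≢ G u~v)
  ... | is-u₂ refl | in-G′ kv   = edge-u₂-list u~v kv
  ... | is-u₄ refl | in-G′ kv   = edge-u₄-list u~v kv
  ... | in-G′ ku   | is-u₂ refl = subst (_ ∈_) (L-sym u₂ u (Adj-sym G u~v)) (edge-u₂-list (Adj-sym G u~v) ku)
  ... | in-G′ ku   | is-u₄ refl = subst (_ ∈_) (L-sym u₄ u (Adj-sym G u~v)) (edge-u₄-list (Adj-sym G u~v) ku)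
  ... | in-G′ ku   | in-G′ kv   = edge-list u v ku kv u~v

  vert-vert′ : ∀ u v → Adj G u v → cv φ u ≢ cv φ v
  vert-vert′ u v u~v with position u | position v
  ... | is-u₂ refl | is-u₄ refl = p≢q
  ... | is-u₄ refl | is-u₂ refl = ≢-sym p≢q
  ... | is-u₂ refl | is-u₂ refl = contradiction refl (Adj⇒≢ G u~v)
  ... | is-u₄ refl | is-u₄ refl = contradiction refl (Adj⇒≢ G u~v)
  ... | is-u₂ refl | in-G′ kv   = p-vertex u~v kv
  ... | is-u₄ refl | in-G′ kv   = q-vertex u~v kv
  ... | in-G′ ku   | is-u₂ refl = ≢-sym (p-vertex (Adj-sym G u~v) ku)
  ... | in-G′ ku   | is-u₄ refl = ≢-sym (q-vertex (Adj-sym G u~v) ku)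
  ... | in-G′ ku   | in-G′ kv   = vert-vert u v ku kv u~v

  vert-edge′ : ∀ u v → Adj G u v → cv φ u ≢ ce φ u v
  vert-edge′ u v u~v with position u | position v
  ... | is-u₂ refl | is-u₄ refl = p≢e
  ... | is-u₄ refl | is-u₂ refl = q≢e
  ... | is-u₂ refl | is-u₂ refl = contradiction refl (Adj⇒≢ G u~v)
  ... | is-u₄ refl | is-u₄ refl = contradiction refl (Adj⇒≢ G u~v)
  ... | is-u₂ refl | in-G′ kv   = p-edge-u₂ u~v kv
  ... | is-u₄ refl | in-G′ kv   = q-edge-u₄ u~v kv
  ... | in-G′ ku   | is-u₂ refl = end-edge-u₂ (Adj-sym G u~v) ku
  ... | in-G′ ku   | is-u₄ refl = end-edge-u₄ (Adj-sym G u~v) ku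
  ... | in-G′ ku   | in-G′ kv   = vert-edge u v ku kv u~v

  edge-edge′ : ∀ u v w → Adj G u v → Adj G u w → v ≢ w → ce φ u v ≢ ce φ u w
  edge-edge′ u v w u~v u~w v≢w with position u | position v | position w
  ... | is-u₂ refl | is-u₂ refl | _          = contradiction refl (Adj⇒≢ G u~v)
  ... | is-u₂ refl | _          | is-u₂ refl = contradiction refl (Adj⇒≢ G u~w)
  ... | is-u₄ refl | is-u₄ refl | _          = contradiction refl (Adj⇒≢ G u~v)
  ... | is-u₄ refl | _          | is-u₄ refl = contradiction refl (Adj⇒≢ G u~w)
  ... | _          | is-u₂ refl | is-u₂ refl = contradiction refl v≢w
  ... | _          | is-u₄ refl | is-u₄ refl = contradiction refl v≢w
  ... | is-u₂ refl | is-u₄ refl | in-G′ kw   = e-edge-u₂ u~w kw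
  ... | is-u₂ refl | in-G′ kv   | is-u₄ refl = ≢-sym (e-edge-u₂ u~v kv)
  ... | is-u₂ refl | in-G′ kv   | in-G′ kw   = edges-u₂-distinct u~v kv u~w kw v≢w
  ... | is-u₄ refl | is-u₂ refl | in-G′ kw   = e-edge-u₄ u~w kw
  ... | is-u₄ refl | in-G′ kv   | is-u₂ refl = ≢-sym (e-edge-u₄ u~v kv)
  ... | is-u₄ refl | in-G′ kv   | in-G′ kw   = edges-u₄-distinct u~v kv u~w kw v≢w
  ... | in-G′ ku   | is-u₂ refl | is-u₄ refl = edge-u₂≢edge-u₄ (Adj-sym G u~v) ku
  ... | in-G′ ku   | is-u₄ refl | is-u₂ refl = ≢-sym (edge-u₂≢edge-u₄ (Adj-sym G u~w) ku)
  ... | in-G′ ku   | is-u₂ refl | in-G′ kw   = edge-u₂-vs-G′ (Adj-sym G u~v) ku u~w kw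
  ... | in-G′ ku   | in-G′ kv   | is-u₂ refl = ≢-sym (edge-u₂-vs-G′ (Adj-sym G u~w) ku u~v kv)
  ... | in-G′ ku   | is-u₄ refl | in-G′ kw   = edge-u₄-vs-G′ (Adj-sym G u~v) ku u~w kw
  ... | in-G′ ku   | in-G′ kv   | is-u₄ refl = ≢-sym (edge-u₄-vs-G′ (Adj-sym G u~w) ku u~v kv)
  ... | in-G′ ku   | in-G′ kv   | in-G′ kw   = edge-edge u v w ku kv kw u~v u~w v≢w

  φ-total : IsTotalColouring G L φ
  φ-total = record
    { edge-sym  = λ u v _ _ → edge-sym′ u v
    ; vert-list = λ u _ → vert-list′ u
    ; edge-list = λ u v _ _ → edge-list′ u v
    ; vert-vert = λ u v _ _ → vert-vert′ u v
    ; edge-edge = λ u v w _ _ _ → edge-edge′ u v w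
    ; vert-edge = λ u v _ _ → vert-edge′ u v }

  keeps-vertices : ∀ w → Kept w → cv φ w ≡ cv φ′ w
  keeps-vertices w kw with position w
  ... | is-u₂ w≡u₂ = contradiction w≡u₂ (kept⇒≢u₂ kw)
  ... | is-u₄ w≡u₄ = contradiction w≡u₄ (kept⇒≢u₄ kw)
  ... | in-G′ _    = refl

  keeps-edges : ∀ u v → Kept u → Kept v → Adj G u v → ce φ u v ≡ ce φ′ u v
  keeps-edges u v ku kv _ with position u | position v
  ... | is-u₂ u≡u₂ | _          = contradiction u≡u₂ (kept⇒≢u₂ ku)
  ... | is-u₄ u≡u₄ | _          = contradiction u≡u₄ (kept⇒≢u₄ ku)
  ... | in-G′ _    | is-u₂ v≡u₂ = contradiction v≡u₂ (kept⇒≢u₂ kv)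
  ... | in-G′ _    | is-u₄ v≡u₄ = contradiction v≡u₄ (kept⇒≢u₄ kv)
  ... | in-G′ _    | in-G′ _    = refl

lemma3p3 : ∀ {n} (G : Graph n) (L : ListAssignment n) (u₁ u₂ u₃ u₄ : Fin n) →
    (∀ u v → Adj G u v → LE L u v ≡ LE L v u) →
    ¬ (u₁ ≡ u₃) →
    Adj G u₁ u₂ → Adj G u₂ u₃ → Adj G u₃ u₄ → Adj G u₄ u₁ → Adj G u₂ u₄ →
    deg G u₂ ≡ 3 → deg G u₄ ≡ 3 →
    (φ' : Colouring n) →
    IsTotalColouringOn G L (minus2 u₂ u₄) φ' →
    6 ≤ card (LavE G L (minus2 u₂ u₄) φ' u₂ u₄) →
    4 ≤ card (LavV G L (minus2 u₂ u₄) φ' u₂) →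
    4 ≤ card (LavV G L (minus2 u₂ u₄) φ' u₄) →
    2 ≤ card (LavE G L (minus2 u₂ u₄) φ' u₁ u₂) →
    2 ≤ card (LavE G L (minus2 u₂ u₄) φ' u₂ u₃) →
    2 ≤ card (LavE G L (minus2 u₂ u₄) φ' u₃ u₄) →
    2 ≤ card (LavE G L (minus2 u₂ u₄) φ' u₁ u₄) →
    (card (LavE G L (minus2 u₂ u₄) φ' u₁ u₂) ≡ 2 →
     card (LavE G L (minus2 u₂ u₄) φ' u₂ u₃) ≡ 2 →
     ¬ SameSet (LavE G L (minus2 u₂ u₄) φ' u₁ u₂) (LavE G L (minus2 u₂ u₄) φ' u₂ u₃)) →
    Σ (Colouring n) λ φ →
      IsTotalColouring G L φ ×
      (∀ w → T (minus2 u₂ u₄ w) → cv φ w ≡ cv φ' w) ×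
      (∀ u v → T (minus2 u₂ u₄ u) → T (minus2 u₂ u₄ v) → Adj G u v → ce φ u v ≡ ce φ' u v)
lemma3p3 G L u₁ u₂ u₃ u₄ L-sym u₁≢u₃ u₁~u₂ u₂~u₃ u₃~u₄ u₄~u₁ u₂~u₄ deg-u₂ deg-u₄ φ′ φ′-total
         6≤E 4≤P 4≤Q 2≤A 2≤B 2≤C 2≤D A≠B =
  φ , φ-total , keeps-vertices , keeps-edges
  where
  open Extend G L u₁ u₂ u₃ u₄ L-sym u₁≢u₃ u₁~u₂ u₂~u₃ u₃~u₄ u₄~u₁ u₂~u₄ deg-u₂ deg-u₄ φ′ φ′-total
    (ChooseColours.extension _ _ _ _ _ _ _ 2≤A 2≤B 2≤C 2≤D 4≤P 4≤Q 6≤E A≠B)
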